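{- For every odd integer $m\ge 3$ and every positive integer $n\equiv 0\pmod 4$, there exists an integer Heffter array $H(m,n)$.
   Context: An integer Heffter array $H(m,n)$ is an $m\times n$ array with entries from $\{ -mn,\dots,mn\}$ such that every row and every column sums to $0$ over the integers and no element from any pair $\{x,-x\}$ appears twice, so the multiset of absolute values of the entries is exactly $\{1,\dots,mn\}$. -}

module Defs where

open import Data.Nat using (ℕ; _*_; _≤_)
open import Data.Integer using (ℤ; ∣_∣; +_; _+_)
open import Data.Fin using (Fin)
open import Data.Product using (_×_; _,_)
open import Relation.Binary.PropositionalEquality using (_≡_)

∑ : ∀ {k} → (Fin k → ℤ) → ℤ
∑ {ℕ.zero}  f = + 0
∑ {ℕ.suc k} f = f Fin.zero + ∑ (λ i → f (Fin.suc i))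

-- An integer Heffter array H(m,n): an m×n array A of integers with
--  * every row sum and every column sum equal to 0 over ℤ,
--  * every absolute value in {1,…,mn},
--  * distinct cells have distinct absolute values (no x, -x both appear,
--    no repeats); hence the absolute values are exactly {1,…,mn}.
record IsIntegerHeffter (m n : ℕ) (A : Fin m → Fin n → ℤ) : Set where
  field
    rowSum : ∀ i → ∑ (λ j → A i j) ≡ + 0
    colSum : ∀ j → ∑ (λ i → A i j) ≡ + 0
    absPos : ∀ i j → 1 ≤ ∣ A i j ∣
    absBound : ∀ i j → ∣ A i j ∣ ≤ m * n
    absInj : ∀ i j i′ j′ → ∣ A i j ∣ ≡ ∣ A i′ j′ ∣ → (i ≡ i′) × (j ≡ j′)

-- Adding four rows to an H(M, n) with 4 ∣ n gives an H(4 + M, n): the new rows take the values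
-- Mn + 1, …, (M + 4)n, placed so that every row and every column of the new 4 × n block meets
-- them in 4-term arithmetic progressions signed + − − +, which sum to zero.  It therefore
-- suffices to construct H(3, 4k) and H(5, 4k) for all k.
--
-- For these, the values 1, …, 4Bk are cut into arithmetic progressions of k terms, and each
-- cell is a signed term of one progression at a position depending affinely on the index of
-- its block of four columns.  Every entry is then an affine function of k and the block index,
-- so the row and column sums are polynomials in k, and their vanishing, the disjointness of the
-- progressions and the injectivity of the placement reduce to finitely many checks on a fixed
-- table, which are decided by evaluation.

module Submission where

open import Defs
open import Data.Nat.Base as ℕ using (ℕ; zero; suc; _≤_; _<_; _%_; s≤s; z≤n)
import Data.Nat.Properties as ℕ
import Data.Nat.DivMod as DivMod
import Data.Nat.Tactic.RingSolver as ℕ-Solver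
open import Data.Integer.Base as ℤ using (ℤ; +_; 0ℤ; -_; ∣_∣; _⊖_; _+_; _*_; _-_)
import Data.Integer.Properties as ℤ
import Data.Integer.Tactic.RingSolver as ℤ-Solver
open import Data.Sign.Base as Sign using (Sign) renaming (+ to ⁺; - to ⁻)
import Data.Sign.Properties as Sign
open import Data.Fin.Base
  using (Fin; zero; suc; toℕ; splitAt; join; combine; remQuot; quotient; remainder; opposite; _↑ˡ_; _↑ʳ_)
open import Data.Fin using (#_)
import Data.Fin.Properties as Finₚ
open import Data.Product.Base as Product using (Σ; _×_; _,_; proj₁; proj₂; uncurry)
open import Data.Sum.Base as Sum using (_⊎_; inj₁; inj₂)
open import Data.Empty using (⊥-elim)
open import Data.Vec.Base using (Vec; _∷_; []; lookup)
open import Function.Base using (_∘_)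
open import Function.Bundles using (Injection)
open import Function.Properties.Inverse using (↔⇒↣)
open import Relation.Nullary.Decidable using (Dec; yes; no; _×-dec_; _⊎-dec_; _→-dec_; ¬?; map′; from-yes)
open import Relation.Binary.Definitions using (DecidableEquality)
open import Relation.Binary.PropositionalEquality

HeffterArray : ℕ → ℕ → Set
HeffterArray m n = Σ (Fin m → Fin n → ℤ) (IsIntegerHeffter m n)

∑-cong : ∀ {k} {f g : Fin k → ℤ} → (∀ i → f i ≡ g i) → ∑ f ≡ ∑ g
∑-cong {zero}  eq = refl
∑-cong {suc k} eq = cong₂ _+_ (eq zero) (∑-cong (eq ∘ suc))

∑-zero : ∀ {k} {f : Fin k → ℤ} → (∀ i → f i ≡ 0ℤ) → ∑ f ≡ 0ℤ
∑-zero {zero}  eq = refl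
∑-zero {suc k} eq = cong₂ _+_ (eq zero) (∑-zero (eq ∘ suc))

∑-splitAt : ∀ m {n} (f : Fin m ⊎ Fin n → ℤ) → ∑ (f ∘ splitAt m) ≡ ∑ (f ∘ inj₁) + ∑ (f ∘ inj₂)
∑-splitAt zero    f = sym (ℤ.+-identityˡ _)
∑-splitAt (suc m) f = trans (cong (_+_ (f (inj₁ zero))) (∑-splitAt m (f ∘ Sum.map₁ suc)))
                            (sym (ℤ.+-assoc (f (inj₁ zero)) _ _))

∑-combine : ∀ k {n} (f : Fin (k ℕ.* n) → ℤ) → ∑ f ≡ ∑ {k} (λ b → ∑ {n} (λ c → f (combine b c)))
∑-combine zero        f = refl
∑-combine (suc k) {n} f = begin
  ∑ f
    ≡⟨ ∑-cong (λ i → cong f (sym (Finₚ.join-splitAt n (k ℕ.* n) i))) ⟩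
  ∑ (f ∘ join n (k ℕ.* n) ∘ splitAt n)
    ≡⟨ ∑-splitAt n (f ∘ join n (k ℕ.* n)) ⟩
  ∑ {n} (λ c → f (c ↑ˡ k ℕ.* n)) + ∑ {k ℕ.* n} (λ i → f (n ↑ʳ i))
    ≡⟨ cong (_+_ (∑ {n} (λ c → f (c ↑ˡ k ℕ.* n)))) (∑-combine k (λ i → f (n ↑ʳ i))) ⟩
  ∑ {suc k} (λ b → ∑ {n} (λ c → f (combine b c))) ∎
  where open ≡-Reasoning

∑-remQuot : ∀ k {n} (f : Fin k → Fin n → ℤ) →
            ∑ (λ j → f (quotient n j) (remainder {k} n j)) ≡ ∑ (λ b → ∑ (f b))
∑-remQuot k {n} f = trans (∑-combine k _)
  (∑-cong {k} λ b → ∑-cong {n} λ c → cong (uncurry f) (Finₚ.remQuot-combine b c))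

splitAt-injective : ∀ m {n} {i j : Fin (m ℕ.+ n)} → splitAt m i ≡ splitAt m j → i ≡ j
splitAt-injective m = Injection.injective (↔⇒↣ Finₚ.+↔⊎)

remQuot-injective : ∀ {k} n {i j : Fin (k ℕ.* n)} → remQuot {k} n i ≡ remQuot n j → i ≡ j
remQuot-injective n = Injection.injective (↔⇒↣ Finₚ.*↔×)

∑-affine : ∀ K (u v : ℤ) → ∑ {K} (λ b → u + v * + toℕ b) * + 2 ≡ + K * (u * + 2 + v * (+ K - + 1))
∑-affine zero    u v = refl
∑-affine (suc K) u v = begin
  (u + v * 0ℤ + ∑ {K} (λ b → u + v * + suc (toℕ b))) * + 2
    ≡⟨ cong (λ s → (u + v * 0ℤ + s) * + 2) (∑-cong {K} λ b → shift u v (+ toℕ b)) ⟩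
  (u + v * 0ℤ + ∑ {K} (λ b → (u + v) + v * + toℕ b)) * + 2
    ≡⟨ ℤ.*-distribʳ-+ (+ 2) (u + v * 0ℤ) _ ⟩
  (u + v * 0ℤ) * + 2 + ∑ {K} (λ b → (u + v) + v * + toℕ b) * + 2
    ≡⟨ cong (_+_ ((u + v * 0ℤ) * + 2)) (∑-affine K (u + v) v) ⟩
  (u + v * 0ℤ) * + 2 + + K * ((u + v) * + 2 + v * (+ K - + 1))
    ≡⟨ close u v (+ K) ⟩
  + suc K * (u * + 2 + v * (+ suc K - + 1)) ∎
  where
  open ≡-Reasoning
  shift : ∀ u v y → u + v * (+ 1 + y) ≡ (u + v) + v * y
  shift = ℤ-Solver.solve-∀
  close : ∀ u v k → (u + v * 0ℤ) * + 2 + k * ((u + v) * + 2 + v * (k - + 1))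
                    ≡ (+ 1 + k) * (u * + 2 + v * ((+ 1 + k) - + 1))
  close = ℤ-Solver.solve-∀

infixr 8 _·_

_·_ : Sign → ℤ → ℤ
⁺ · x = x
⁻ · x = - x

∣·∣ : ∀ s x → ∣ s · x ∣ ≡ ∣ x ∣
∣·∣ ⁺ x = refl
∣·∣ ⁻ x = ℤ.∣-i∣≡∣i∣ x

·-distrib-+ : ∀ s x y → s · (x + y) ≡ s · x + s · y
·-distrib-+ ⁺ x y = refl
·-distrib-+ ⁻ x y = ℤ.neg-distrib-+ x y

*-· : ∀ s t x → (s Sign.* t) · x ≡ s · t · x
*-· ⁺ t x = refl
*-· ⁻ ⁺ x = refl
*-· ⁻ ⁻ x = sym (ℤ.neg-involutive x)

∑-· : ∀ {k} s (f : Fin k → ℤ) → ∑ (λ i → s · f i) ≡ s · ∑ f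
∑-· {zero}  ⁺ f = refl
∑-· {zero}  ⁻ f = refl
∑-· {suc k} s f = trans (cong (_+_ (s · f zero)) (∑-· s (f ∘ suc))) (sym (·-distrib-+ s _ _))

·-zero : ∀ s → s · 0ℤ ≡ 0ℤ
·-zero ⁺ = refl
·-zero ⁻ = refl

pattern₄ : Fin 4 → Sign
pattern₄ zero                   = ⁺
pattern₄ (suc zero)             = ⁻
pattern₄ (suc (suc zero))       = ⁻
pattern₄ (suc (suc (suc zero))) = ⁺

pattern₄-cancels : ∀ s (x a : ℤ) → ∑ (λ c → (s Sign.* pattern₄ c) · (x + a * + toℕ c)) ≡ 0ℤ
pattern₄-cancels s x a = begin
  ∑ (λ c → (s Sign.* pattern₄ c) · (x + a * + toℕ c)) ≡⟨ ∑-cong (λ c → *-· s (pattern₄ c) (x + a * + toℕ c)) ⟩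
  ∑ (λ c → s · pattern₄ c · (x + a * + toℕ c))        ≡⟨ ∑-· s (λ c → pattern₄ c · (x + a * + toℕ c)) ⟩
  s · ∑ (λ c → pattern₄ c · (x + a * + toℕ c))        ≡⟨ cong (s ·_) (four-terms x a) ⟩
  s · 0ℤ                                              ≡⟨ ·-zero s ⟩
  0ℤ                                                  ∎
  where
  open ≡-Reasoning
  four-terms : ∀ x a → x + a * + 0 + (- (x + a * + 1) + (- (x + a * + 2) + (x + a * + 3 + 0ℤ))) ≡ 0ℤ
  four-terms = ℤ-Solver.solve-∀

pos-linear : ∀ x a c → + (x ℕ.+ a ℕ.* c) ≡ + x + + a * + c
pos-linear x a c = trans (ℤ.pos-+ x (a ℕ.* c)) (cong (_+_ (+ x)) (ℤ.pos-* a c))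

pos-affine : ∀ a b c e f → + (a ℕ.+ b ℕ.* c ℕ.+ e ℕ.* f) ≡ + a + + b * + c + + e * + f
pos-affine a b c e f = trans (pos-linear (a ℕ.+ b ℕ.* c) e f) (cong (λ z → z + + e * + f) (pos-linear a b c))

-- Stacking four rows

module Stack {M k : ℕ} (A : Fin M → Fin (k ℕ.* 4) → ℤ) (H : IsIntegerHeffter M (k ℕ.* 4) A) where
  open IsIntegerHeffter H

  n : ℕ
  n = k ℕ.* 4

  topValue : Fin 4 → Fin n → ℕ
  topValue d j = suc (M ℕ.* n ℕ.+ toℕ (combine j d))

  top : Fin 4 → Fin n → ℤ
  top d j = (pattern₄ d Sign.* pattern₄ (remainder {k} 4 j)) · + topValue d j

  top-row : ∀ d → ∑ (top d) ≡ 0ℤ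
  top-row d = trans (∑-combine k (top d))
    (∑-zero λ b → trans (∑-cong (along-row b)) (pattern₄-cancels (pattern₄ d) (+ start b) (+ 4)))
    where
    start : Fin k → ℕ
    start b = suc (M ℕ.* n ℕ.+ (16 ℕ.* toℕ b ℕ.+ toℕ d))
    value : ∀ b c → topValue d (combine b c) ≡ start b ℕ.+ 4 ℕ.* toℕ c
    value b c = begin
      suc (M ℕ.* n ℕ.+ toℕ (combine (combine b c) d))
        ≡⟨ cong (λ z → suc (M ℕ.* n ℕ.+ z)) (Finₚ.toℕ-combine (combine b c) d) ⟩
      suc (M ℕ.* n ℕ.+ (4 ℕ.* toℕ (combine b c) ℕ.+ toℕ d))
        ≡⟨ cong (λ z → suc (M ℕ.* n ℕ.+ (4 ℕ.* z ℕ.+ toℕ d))) (Finₚ.toℕ-combine b c) ⟩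
      suc (M ℕ.* n ℕ.+ (4 ℕ.* (4 ℕ.* toℕ b ℕ.+ toℕ c) ℕ.+ toℕ d))
        ≡⟨ regroup (M ℕ.* n) (toℕ b) (toℕ c) (toℕ d) ⟩
      start b ℕ.+ 4 ℕ.* toℕ c ∎
      where
      open ≡-Reasoning
      regroup : ∀ a x y z → suc (a ℕ.+ (4 ℕ.* (4 ℕ.* x ℕ.+ y) ℕ.+ z)) ≡ suc (a ℕ.+ (16 ℕ.* x ℕ.+ z)) ℕ.+ 4 ℕ.* y
      regroup = ℕ-Solver.solve-∀
    along-row : ∀ b c → top d (combine b c) ≡ (pattern₄ d Sign.* pattern₄ c) · (+ start b + + 4 * + toℕ c)
    along-row b c = cong₂ (λ r v → (pattern₄ d Sign.* pattern₄ r) · v)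
      (cong proj₂ (Finₚ.remQuot-combine b c)) (trans (cong +_ (value b c)) (pos-linear (start b) 4 (toℕ c)))

  top-column : ∀ j → ∑ (λ d → top d j) ≡ 0ℤ
  top-column j = trans (∑-cong along-column) (pattern₄-cancels (pattern₄ (remainder {k} 4 j)) (+ start) (+ 1))
    where
    start : ℕ
    start = suc (M ℕ.* n ℕ.+ 4 ℕ.* toℕ j)
    value : ∀ d → topValue d j ≡ start ℕ.+ 1 ℕ.* toℕ d
    value d = trans (cong (λ z → suc (M ℕ.* n ℕ.+ z)) (Finₚ.toℕ-combine j d)) (regroup (M ℕ.* n) (toℕ j) (toℕ d))
      where
      regroup : ∀ a x z → suc (a ℕ.+ (4 ℕ.* x ℕ.+ z)) ≡ suc (a ℕ.+ 4 ℕ.* x) ℕ.+ 1 ℕ.* z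
      regroup = ℕ-Solver.solve-∀
    along-column : ∀ d → top d j ≡ (pattern₄ (remainder {k} 4 j) Sign.* pattern₄ d) · (+ start + + 1 * + toℕ d)
    along-column d = cong₂ _·_ (Sign.*-comm (pattern₄ d) _) (trans (cong +_ (value d)) (pos-linear start 1 (toℕ d)))

  entry : Fin 4 ⊎ Fin M → Fin n → ℤ
  entry (inj₁ d) = top d
  entry (inj₂ a) = A a

  stacked : Fin (4 ℕ.+ M) → Fin n → ℤ
  stacked i = entry (splitAt 4 i)

  row : ∀ x → ∑ (entry x) ≡ 0ℤ
  row (inj₁ d) = top-row d
  row (inj₂ a) = rowSum a

  column : ∀ j → ∑ (λ i → stacked i j) ≡ 0ℤ
  column j = trans (∑-splitAt 4 (λ x → entry x j)) (cong₂ _+_ (top-column j) (colSum j))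

  ∣top∣ : ∀ d j → ∣ top d j ∣ ≡ topValue d j
  ∣top∣ d j = ∣·∣ (pattern₄ d Sign.* pattern₄ (remainder {k} 4 j)) (+ topValue d j)

  size : M ℕ.* n ℕ.+ n ℕ.* 4 ≡ (4 ℕ.+ M) ℕ.* n
  size = regroup M n
    where
    regroup : ∀ M n → M ℕ.* n ℕ.+ n ℕ.* 4 ≡ (4 ℕ.+ M) ℕ.* n
    regroup = ℕ-Solver.solve-∀

  topValue≤ : ∀ d j → topValue d j ≤ (4 ℕ.+ M) ℕ.* n
  topValue≤ d j = ℕ.≤-trans (ℕ.≤-reflexive (sym (ℕ.+-suc (M ℕ.* n) _)))
    (ℕ.≤-trans (ℕ.+-monoʳ-≤ (M ℕ.* n) (Finₚ.toℕ<n (combine j d))) (ℕ.≤-reflexive size))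

  old<topValue : ∀ a j d j′ → ∣ A a j ∣ < topValue d j′
  old<topValue a j d j′ = s≤s (ℕ.≤-trans (absBound a j) (ℕ.m≤m+n (M ℕ.* n) _))

  positive : ∀ x j → 1 ≤ ∣ entry x j ∣
  positive (inj₁ d) j = subst (1 ≤_) (sym (∣top∣ d j)) (s≤s z≤n)
  positive (inj₂ a) j = absPos a j

  bounded : ∀ x j → ∣ entry x j ∣ ≤ (4 ℕ.+ M) ℕ.* n
  bounded (inj₁ d) j = subst (_≤ (4 ℕ.+ M) ℕ.* n) (sym (∣top∣ d j)) (topValue≤ d j)
  bounded (inj₂ a) j = ℕ.≤-trans (absBound a j) (ℕ.≤-trans (ℕ.m≤m+n (M ℕ.* n) (n ℕ.* 4)) (ℕ.≤-reflexive size))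

  distinct : ∀ x j x′ j′ → ∣ entry x j ∣ ≡ ∣ entry x′ j′ ∣ → x ≡ x′ × j ≡ j′
  distinct (inj₁ d) j (inj₁ d′) j′ eq with Finₚ.combine-injective j d j′ d′ (Finₚ.toℕ-injective
    (ℕ.+-cancelˡ-≡ (M ℕ.* n) _ _ (ℕ.suc-injective (trans (sym (∣top∣ d j)) (trans eq (∣top∣ d′ j′))))))
  ... | refl , refl = refl , refl
  distinct (inj₁ d) j (inj₂ a) j′ eq =
    ⊥-elim (ℕ.<⇒≢ (old<topValue a j′ d j) (trans (sym eq) (∣top∣ d j)))
  distinct (inj₂ a) j (inj₁ d) j′ eq =
    ⊥-elim (ℕ.<⇒≢ (old<topValue a j d j′) (trans eq (∣top∣ d j′)))
  distinct (inj₂ a) j (inj₂ a′) j′ eq with absInj a j a′ j′ eq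
  ... | refl , refl = refl , refl

  isHeffter : IsIntegerHeffter (4 ℕ.+ M) n stacked
  isHeffter = record
    { rowSum   = λ i → row (splitAt 4 i)
    ; colSum   = column
    ; absPos   = λ i → positive (splitAt 4 i)
    ; absBound = λ i → bounded (splitAt 4 i)
    ; absInj   = λ i j i′ j′ eq → Product.map₁ (splitAt-injective 4) (distinct (splitAt 4 i) j (splitAt 4 i′) j′ eq)
    }

stack : ∀ {M k} → HeffterArray M (k ℕ.* 4) → HeffterArray (4 ℕ.+ M) (k ℕ.* 4)
stack {M} {k} (A , H) = Stack.stacked {M} {k} A H , Stack.isHeffter A H

-- Affine forms in K and the block index

record Form : Set where
  constructor form
  field
    α β γ : ℤ

open Form

⟦_⟧ : Form → ℕ → ℕ → ℤ
⟦ form a b c ⟧ K x = a + b * + K + c * + x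

_·ᶠ_ : Sign → Form → Form
s ·ᶠ form a b c = form (s · a) (s · b) (s · c)

∑ᶠ : ∀ {k} → (Fin k → Form) → Form
∑ᶠ f = form (∑ (α ∘ f)) (∑ (β ∘ f)) (∑ (γ ∘ f))

⟦·ᶠ⟧ : ∀ s f K x → ⟦ s ·ᶠ f ⟧ K x ≡ s · ⟦ f ⟧ K x
⟦·ᶠ⟧ ⁺ f            K x = refl
⟦·ᶠ⟧ ⁻ (form a b c) K x = negate a b c (+ K) (+ x)
  where
  negate : ∀ a b c k y → - a + - b * k + - c * y ≡ - (a + b * k + c * y)
  negate = ℤ-Solver.solve-∀

⟦∑ᶠ⟧ : ∀ {k} (f : Fin k → Form) K x → ⟦ ∑ᶠ f ⟧ K x ≡ ∑ (λ i → ⟦ f i ⟧ K x)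
⟦∑ᶠ⟧ {zero}  f K x = refl
⟦∑ᶠ⟧ {suc k} f K x = trans
  (regroup (α (f zero)) (β (f zero)) (γ (f zero)) (∑ (α ∘ f ∘ suc)) (∑ (β ∘ f ∘ suc)) (∑ (γ ∘ f ∘ suc)) (+ K) (+ x))
  (cong (_+_ (⟦ f zero ⟧ K x)) (⟦∑ᶠ⟧ (f ∘ suc) K x))
  where
  regroup : ∀ a b c a′ b′ c′ k y →
            a + a′ + (b + b′) * k + (c + c′) * y ≡ (a + b * k + c * y) + (a′ + b′ * k + c′ * y)
  regroup = ℤ-Solver.solve-∀

∣signed∣ : ∀ s f K x {n} → + n ≡ ⟦ f ⟧ K x → ∣ ⟦ s ·ᶠ f ⟧ K x ∣ ≡ n
∣signed∣ s f K x eq = trans (cong ∣_∣ (trans (⟦·ᶠ⟧ s f K x) (cong (s ·_) (sym eq)))) (∣·∣ s _)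

IsZero : Form → Set
IsZero (form a b c) = a ≡ 0ℤ × b ≡ 0ℤ × c ≡ 0ℤ

isZero? : ∀ f → Dec (IsZero f)
isZero? (form a b c) = (a ℤ.≟ 0ℤ) ×-dec (b ℤ.≟ 0ℤ) ×-dec (c ℤ.≟ 0ℤ)

⟦⟧-zero : ∀ f K x → IsZero f → ⟦ f ⟧ K x ≡ 0ℤ
⟦⟧-zero (form _ _ _) K x (refl , refl , refl) = refl

-- Twice the row total ∑_{x<K} ⟦ R ⟧ K x + ⟦ Q ⟧ K 0 is a quadratic in K; these are its coefficients.
RowBalanced : Form → Form → Set
RowBalanced (form a b c) (form a′ b′ _) = b * + 2 + c ≡ 0ℤ × a * + 2 - c + b′ * + 2 ≡ 0ℤ × a′ ≡ 0ℤ

rowBalanced? : ∀ R Q → Dec (RowBalanced R Q)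
rowBalanced? (form a b c) (form a′ b′ _) =
  (b * + 2 + c ℤ.≟ 0ℤ) ×-dec (a * + 2 - c + b′ * + 2 ℤ.≟ 0ℤ) ×-dec (a′ ℤ.≟ 0ℤ)

balanced-row : ∀ R Q K → RowBalanced R Q → ⟦ Q ⟧ K 0 + ∑ {K} (λ x → ⟦ R ⟧ K (toℕ x)) ≡ 0ℤ
balanced-row (form a b c) (form a′ b′ c′) K (e₁ , e₂ , e₃) = ℤ.*-cancelʳ-≡ _ 0ℤ (+ 2) (begin
  (q + ∑ {K} (λ x → a + b * + K + c * + toℕ x)) * + 2
    ≡⟨ ℤ.*-distribʳ-+ (+ 2) q (∑ {K} (λ x → a + b * + K + c * + toℕ x)) ⟩
  q * + 2 + ∑ {K} (λ x → a + b * + K + c * + toℕ x) * + 2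
    ≡⟨ cong (_+_ (q * + 2)) (∑-affine K (a + b * + K) c) ⟩
  q * + 2 + + K * ((a + b * + K) * + 2 + c * (+ K - + 1))
    ≡⟨ collect a b c a′ b′ c′ (+ K) ⟩
  (b * + 2 + c) * (+ K * + K) + (a * + 2 - c + b′ * + 2) * + K + a′ * + 2
    ≡⟨ cong₂ (λ u v → u * (+ K * + K) + v * + K + a′ * + 2) e₁ e₂ ⟩
  0ℤ * (+ K * + K) + 0ℤ * + K + a′ * + 2
    ≡⟨ cong (λ w → 0ℤ * (+ K * + K) + 0ℤ * + K + w * + 2) e₃ ⟩
  0ℤ ∎)
  where
  open ≡-Reasoning
  q : ℤ
  q = a′ + b′ * + K + c′ * 0ℤ
  collect : ∀ a b c a′ b′ c′ k →
            (a′ + b′ * k + c′ * 0ℤ) * + 2 + k * ((a + b * k) * + 2 + c * (k - + 1))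
            ≡ (b * + 2 + c) * (k * k) + (a * + 2 - c + b′ * + 2) * k + a′ * + 2
  collect = ℤ-Solver.solve-∀

-- Arithmetic progressions of absolute values

quot-rem-unique : ∀ {d t t′ p p′} → t < d → t′ < d → t ℕ.+ p ℕ.* d ≡ t′ ℕ.+ p′ ℕ.* d → t ≡ t′ × p ≡ p′
quot-rem-unique {suc d} {t} {t′} {p} {p′} t<d t′<d eq = t≡t′ , p≡p′
  where
  t≡t′ : t ≡ t′
  t≡t′ = begin
    t                             ≡⟨ DivMod.m<n⇒m%n≡m t<d ⟨
    t % suc d                     ≡⟨ DivMod.[m+kn]%n≡m%n t p (suc d) ⟨
    (t ℕ.+ p ℕ.* suc d) % suc d   ≡⟨ cong (_% suc d) eq ⟩
    (t′ ℕ.+ p′ ℕ.* suc d) % suc d ≡⟨ DivMod.[m+kn]%n≡m%n t′ p′ (suc d) ⟩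
    t′ % suc d                    ≡⟨ DivMod.m<n⇒m%n≡m t′<d ⟩
    t′                            ∎
    where open ≡-Reasoning
  p≡p′ : p ≡ p′
  p≡p′ = ℕ.*-cancelʳ-≡ p p′ (suc d) (ℕ.+-cancelˡ-≡ t _ _ (trans eq (cong (ℕ._+ p′ ℕ.* suc d) (sym t≡t′))))

record Progression : Set where
  constructor prog
  field
    start step offset : ℕ

open Progression

-- For t < d and p < k, the terms with offsets 0, …, d - 1 fill (S·k, (S + d)·k] exactly once.
term : Progression → ℕ → ℕ → ℕ
term (prog S d t) k p = suc (S ℕ.* k ℕ.+ (t ℕ.+ p ℕ.* d))

Fits : ℕ → Progression → Set
Fits N (prog S d t) = t < d × S ℕ.+ d ≤ N

fits? : ∀ N ℓ → Dec (Fits N ℓ)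
fits? N (prog S d t) = (t ℕ.<? d) ×-dec (S ℕ.+ d ℕ.≤? N)

NonOverlapping : Progression → Progression → Set
NonOverlapping (prog S d t) (prog S′ d′ t′) = S ℕ.+ d ≤ S′ ⊎ S′ ℕ.+ d′ ≤ S ⊎ S ≡ S′ × d ≡ d′ × t ≢ t′

nonOverlapping? : ∀ ℓ ℓ′ → Dec (NonOverlapping ℓ ℓ′)
nonOverlapping? (prog S d t) (prog S′ d′ t′) =
  (S ℕ.+ d ℕ.≤? S′) ⊎-dec (S′ ℕ.+ d′ ℕ.≤? S) ⊎-dec (S ℕ.≟ S′) ×-dec (d ℕ.≟ d′) ×-dec ¬? (t ℕ.≟ t′)

term-≤ : ∀ ℓ {k p} → offset ℓ < step ℓ → p < k → term ℓ k p ≤ (start ℓ ℕ.+ step ℓ) ℕ.* k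
term-≤ (prog S d t) {k} {p} t<d p<k = begin
  suc (S ℕ.* k ℕ.+ (t ℕ.+ p ℕ.* d)) ≡⟨ ℕ.+-suc (S ℕ.* k) _ ⟨
  S ℕ.* k ℕ.+ (suc t ℕ.+ p ℕ.* d)   ≤⟨ ℕ.+-monoʳ-≤ (S ℕ.* k) (ℕ.+-monoˡ-≤ (p ℕ.* d) t<d) ⟩
  S ℕ.* k ℕ.+ suc p ℕ.* d           ≤⟨ ℕ.+-monoʳ-≤ (S ℕ.* k) (ℕ.*-monoˡ-≤ d p<k) ⟩
  S ℕ.* k ℕ.+ k ℕ.* d               ≡⟨ regroup S d k ⟩
  (S ℕ.+ d) ℕ.* k                   ∎
  where
  open ℕ.≤-Reasoning
  regroup : ∀ S d k → S ℕ.* k ℕ.+ k ℕ.* d ≡ (S ℕ.+ d) ℕ.* k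
  regroup = ℕ-Solver.solve-∀

term-> : ∀ S d t k p → S ℕ.* k < term (prog S d t) k p
term-> S d t k p = s≤s (ℕ.m≤m+n (S ℕ.* k) _)

term-within-chunk : ∀ {S d t t′ k p p′} → t < d → t′ < d →
                    term (prog S d t) k p ≡ term (prog S d t′) k p′ → t ≡ t′ × p ≡ p′
term-within-chunk {S} {k = k} t<d t′<d eq =
  quot-rem-unique t<d t′<d (ℕ.+-cancelˡ-≡ (S ℕ.* k) _ _ (ℕ.suc-injective eq))

term-apart : ∀ {ℓ ℓ′ k p p′} → NonOverlapping ℓ ℓ′ → offset ℓ < step ℓ → offset ℓ′ < step ℓ′ →
             p < k → p′ < k → term ℓ k p ≢ term ℓ′ k p′
term-apart {prog S d t} {prog S′ d′ t′} {k} {p} {p′} (inj₁ le) t<d _ p<k p′<k =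
  ℕ.<⇒≢ (ℕ.≤-<-trans (ℕ.≤-trans (term-≤ (prog S d t) t<d p<k) (ℕ.*-monoˡ-≤ k le)) (term-> S′ d′ t′ k p′))
term-apart {prog S d t} {prog S′ d′ t′} {k} {p} {p′} (inj₂ (inj₁ le)) _ t′<d′ p<k p′<k =
  ℕ.<⇒≢ (ℕ.≤-<-trans (ℕ.≤-trans (term-≤ (prog S′ d′ t′) t′<d′ p′<k) (ℕ.*-monoˡ-≤ k le)) (term-> S d t k p)) ∘ sym
term-apart {prog S d t} {prog S d t′} {k} {p} {p′} (inj₂ (inj₂ (refl , refl , t≢t′))) t<d t′<d _ _ =
  t≢t′ ∘ proj₁ ∘ term-within-chunk {S} {d} {t} {t′} {k} {p} {p′} t<d t′<d

term-injectiveʳ : ∀ ℓ {k p p′} → offset ℓ < step ℓ → term ℓ k p ≡ term ℓ k p′ → p ≡ p′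
term-injectiveʳ (prog S d t) t<d = proj₂ ∘ term-within-chunk {S} {d} {t} t<d t<d

-- Placing blocks on progressions

data Placement : Set where
  up down : ℕ → Placement

window : Placement → ℕ
window (up w)   = w
window (down w) = w

position : ∀ {K} → Placement → Fin K → ℕ
position (up w)   b = w ℕ.+ toℕ b
position (down w) b = w ℕ.+ toℕ (opposite b)

data Slot : Set where
  below above : ℕ → Slot

_≟ˢ_ : DecidableEquality Slot
below p ≟ˢ below p′ = map′ (cong below) (λ { refl → refl }) (p ℕ.≟ p′)
above h ≟ˢ above h′ = map′ (cong above) (λ { refl → refl }) (h ℕ.≟ h′)
below _ ≟ˢ above _  = no λ ()
above _ ≟ˢ below _  = no λ ()

slotPosition : ℕ → Slot → ℕ
slotPosition K (below p) = p
slotPosition K (above h) = h ℕ.+ K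

Outside : ℕ → Placement → Slot → Set
Outside L pl (below p) = p < window pl
Outside L pl (above h) = window pl ≤ h × h < L

outside? : ∀ L pl sl → Dec (Outside L pl sl)
outside? L pl (below p) = p ℕ.<? window pl
outside? L pl (above h) = (window pl ℕ.≤? h) ×-dec (h ℕ.<? L)

module _ {K : ℕ} where

  window≤position : ∀ pl (b : Fin K) → window pl ≤ position pl b
  window≤position (up w)   b = ℕ.m≤m+n w _
  window≤position (down w) b = ℕ.m≤m+n w _

  position<window+K : ∀ pl (b : Fin K) → position pl b < window pl ℕ.+ K
  position<window+K (up w)   b = ℕ.+-monoʳ-< w (Finₚ.toℕ<n b)
  position<window+K (down w) b = ℕ.+-monoʳ-< w (Finₚ.toℕ<n (opposite b))

  position-injective : ∀ pl {b b′ : Fin K} → position pl b ≡ position pl b′ → b ≡ b′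
  position-injective (up w) eq = Finₚ.toℕ-injective (ℕ.+-cancelˡ-≡ w _ _ eq)
  position-injective (down w) {b} {b′} eq = begin
    b                      ≡⟨ Finₚ.opposite-involutive b ⟨
    opposite (opposite b)  ≡⟨ cong opposite (Finₚ.toℕ-injective (ℕ.+-cancelˡ-≡ w _ _ eq)) ⟩
    opposite (opposite b′) ≡⟨ Finₚ.opposite-involutive b′ ⟩
    b′                     ∎
    where open ≡-Reasoning

  position< : ∀ {L} pl (b : Fin K) → window pl ≤ L → position pl b < L ℕ.+ K
  position< pl b w≤L = ℕ.<-≤-trans (position<window+K pl b) (ℕ.+-monoˡ-≤ K w≤L)

  slotPosition< : ∀ {L} pl sl → Outside L pl sl → window pl ≤ L → slotPosition K sl < L ℕ.+ K
  slotPosition< pl (below p) p<w w≤L = ℕ.<-≤-trans p<w (ℕ.≤-trans w≤L (ℕ.m≤m+n _ K))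
  slotPosition< pl (above h) (_ , h<L) _ = ℕ.+-monoˡ-< K h<L

  position≢slotPosition : ∀ {L} pl (b : Fin K) sl → Outside L pl sl → position pl b ≢ slotPosition K sl
  position≢slotPosition pl b (below p) p<w = ℕ.<⇒≢ (ℕ.<-≤-trans p<w (window≤position pl b)) ∘ sym
  position≢slotPosition pl b (above h) (w≤h , _) =
    ℕ.<⇒≢ (ℕ.<-≤-trans (position<window+K pl b) (ℕ.+-monoˡ-≤ K w≤h))

  slotPosition-injective : ∀ {L} pl sl sl′ → Outside L pl sl → Outside L pl sl′ →
                           slotPosition K sl ≡ slotPosition K sl′ → sl ≡ sl′
  slotPosition-injective pl (below p) (below p′) _ _ eq = cong below eq
  slotPosition-injective pl (above h) (above h′) _ _ eq = cong above (ℕ.+-cancelʳ-≡ K h h′ eq)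
  slotPosition-injective pl (below p) (above h) p<w (w≤h , _) eq =
    ⊥-elim (ℕ.<⇒≢ (ℕ.<-≤-trans p<w (ℕ.≤-trans w≤h (ℕ.m≤m+n h K))) eq)
  slotPosition-injective pl (above h) (below p) (w≤h , _) p<w eq =
    ⊥-elim (ℕ.<⇒≢ (ℕ.<-≤-trans p<w (ℕ.≤-trans w≤h (ℕ.m≤m+n h K))) (sym eq))

placementForm : ℕ → Progression → Placement → Form
placementForm L (prog S d t) (up w)   = form (+ (1 ℕ.+ S ℕ.* L ℕ.+ t ℕ.+ w ℕ.* d)) (+ S) (+ d)
placementForm L (prog S d t) (down w) = form (+ (1 ℕ.+ S ℕ.* L ℕ.+ t ℕ.+ w ℕ.* d) - + d) (+ S + + d) (- + d)

slotForm : ℕ → Progression → Slot → Form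
slotForm L (prog S d t) (below p) = form (+ (1 ℕ.+ S ℕ.* L ℕ.+ t ℕ.+ p ℕ.* d)) (+ S) 0ℤ
slotForm L (prog S d t) (above h) = form (+ (1 ℕ.+ S ℕ.* L ℕ.+ t ℕ.+ h ℕ.* d)) (+ (S ℕ.+ d)) 0ℤ

+toℕ-opposite : ∀ {K} (b : Fin K) → + toℕ (opposite b) ≡ + K - + 1 - + toℕ b
+toℕ-opposite {K} b = begin
  + toℕ (opposite b)     ≡⟨ cong +_ (Finₚ.opposite-prop b) ⟩
  + (K ℕ.∸ suc (toℕ b))  ≡⟨ ℤ.⊖-≥ (Finₚ.toℕ<n b) ⟨
  K ⊖ suc (toℕ b)        ≡⟨ ℤ.m-n≡m⊖n K (suc (toℕ b)) ⟨
  + K - (+ 1 + + toℕ b)  ≡⟨ split (+ K) (+ toℕ b) ⟩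
  + K - + 1 - + toℕ b    ∎
  where
  open ≡-Reasoning
  split : ∀ k x → k - (+ 1 + x) ≡ k - + 1 - x
  split = ℤ-Solver.solve-∀

module _ (L K : ℕ) where

  term-up : ∀ ℓ w x → + term ℓ (L ℕ.+ K) (w ℕ.+ x) ≡ ⟦ placementForm L ℓ (up w) ⟧ K x
  term-up (prog S d t) w x = trans (cong +_ (expand S d t L K w x)) (pos-affine _ S K d x)
    where
    expand : ∀ S d t L K w x → suc (S ℕ.* (L ℕ.+ K) ℕ.+ (t ℕ.+ (w ℕ.+ x) ℕ.* d))
                               ≡ 1 ℕ.+ S ℕ.* L ℕ.+ t ℕ.+ w ℕ.* d ℕ.+ S ℕ.* K ℕ.+ d ℕ.* x
    expand = ℕ-Solver.solve-∀

  term-placement : ∀ ℓ pl (b : Fin K) → + term ℓ (L ℕ.+ K) (position pl b) ≡ ⟦ placementForm L ℓ pl ⟧ K (toℕ b)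
  term-placement ℓ (up w) b = term-up ℓ w (toℕ b)
  term-placement ℓ@(prog S d t) (down w) b = begin
    + term ℓ (L ℕ.+ K) (w ℕ.+ toℕ (opposite b))   ≡⟨ term-up ℓ w (toℕ (opposite b)) ⟩
    a + + S * + K + + d * + toℕ (opposite b)      ≡⟨ cong (λ z → a + + S * + K + + d * z) (+toℕ-opposite b) ⟩
    a + + S * + K + + d * (+ K - + 1 - + toℕ b)   ≡⟨ reverse a (+ S) (+ d) (+ K) (+ toℕ b) ⟩
    ⟦ placementForm L ℓ (down w) ⟧ K (toℕ b)      ∎
    where
    open ≡-Reasoning
    a : ℤ
    a = + (1 ℕ.+ S ℕ.* L ℕ.+ t ℕ.+ w ℕ.* d)
    reverse : ∀ a s d k x → a + s * k + d * (k - + 1 - x) ≡ a - d + (s + d) * k + - d * x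
    reverse = ℤ-Solver.solve-∀

  term-slot : ∀ ℓ sl → + term ℓ (L ℕ.+ K) (slotPosition K sl) ≡ ⟦ slotForm L ℓ sl ⟧ K 0
  term-slot (prog S d t) (below p) = trans (cong +_ (expand S d t L K p)) (pos-affine _ S K 0 0)
    where
    expand : ∀ S d t L K p → suc (S ℕ.* (L ℕ.+ K) ℕ.+ (t ℕ.+ p ℕ.* d))
                             ≡ 1 ℕ.+ S ℕ.* L ℕ.+ t ℕ.+ p ℕ.* d ℕ.+ S ℕ.* K ℕ.+ 0 ℕ.* 0
    expand = ℕ-Solver.solve-∀
  term-slot (prog S d t) (above h) = trans (cong +_ (expand S d t L K h)) (pos-affine _ (S ℕ.+ d) K 0 0)
    where
    expand : ∀ S d t L K h → suc (S ℕ.* (L ℕ.+ K) ℕ.+ (t ℕ.+ (h ℕ.+ K) ℕ.* d))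
                             ≡ 1 ℕ.+ S ℕ.* L ℕ.+ t ℕ.+ h ℕ.* d ℕ.+ (S ℕ.+ d) ℕ.* K ℕ.+ 0 ℕ.* 0
    expand = ℕ-Solver.solve-∀

-- A table describes, for every K, a B × 4(L + K) array whose columns form L special and K regular
-- blocks of four.  In regular block b, cell (i, c) is ± a term of the progression e = regularLine i c
-- at position `position (placementOf e) b`, an affine function of K and b; in special block s it is
-- ± a term at a slot outside the window used by the regular blocks, affine in K alone.
record Table (B L NL : ℕ) : Set where
  field
    progressionOf : Fin NL → Progression
    placementOf   : Fin NL → Placement
    regularLine   : Fin B → Fin 4 → Fin NL
    regularSign   : Fin B → Fin 4 → Sign
    specialLine   : Fin L → Fin B → Fin 4 → Fin NL
    specialSign   : Fin L → Fin B → Fin 4 → Sign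
    specialSlot   : Fin L → Fin B → Fin 4 → Slot

module _ {B L NL : ℕ} (T : Table B L NL) where
  open Table T

  regularForm : Fin B → Fin 4 → Form
  regularForm i c = regularSign i c ·ᶠ placementForm L (progressionOf (regularLine i c)) (placementOf (regularLine i c))

  specialForm : Fin L → Fin B → Fin 4 → Form
  specialForm s i c = specialSign s i c ·ᶠ slotForm L (progressionOf (specialLine s i c)) (specialSlot s i c)

  record Valid : Set where
    field
      regularColumns : ∀ c → IsZero (∑ᶠ λ i → regularForm i c)
      specialColumns : ∀ s c → IsZero (∑ᶠ λ i → specialForm s i c)
      balancedRows   : ∀ i → RowBalanced (∑ᶠ (regularForm i)) (∑ᶠ λ s → ∑ᶠ (specialForm s i))
      fits           : ∀ e → Fits (B ℕ.* 4) (progressionOf e)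
      nonOverlapping : ∀ e e′ → e ≢ e′ → NonOverlapping (progressionOf e) (progressionOf e′)
      windowFits     : ∀ e → window (placementOf e) ≤ L
      slotsOutside   : ∀ s i c → Outside L (placementOf (specialLine s i c)) (specialSlot s i c)
      regularLine-injective : ∀ i c i′ c′ → regularLine i c ≡ regularLine i′ c′ → i ≡ i′ × c ≡ c′
      specialLine-injective : ∀ s i c s′ i′ c′ → specialLine s i c ≡ specialLine s′ i′ c′ →
                              specialSlot s i c ≡ specialSlot s′ i′ c′ → s ≡ s′ × i ≡ i′ × c ≡ c′

  valid? : Dec Valid
  valid? = map′
    (λ (a , b , c , d , e , f , g , h , i) → record
      { regularColumns = a ; specialColumns = b ; balancedRows = c ; fits = d ; nonOverlapping = e
      ; windowFits = f ; slotsOutside = g ; regularLine-injective = h ; specialLine-injective = i })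
    (λ v → let open Valid v in
      regularColumns , specialColumns , balancedRows , fits , nonOverlapping ,
      windowFits , slotsOutside , regularLine-injective , specialLine-injective)
    (all? (λ c → isZero? (∑ᶠ λ i → regularForm i c)) ×-dec
     all? (λ s → all? λ c → isZero? (∑ᶠ λ i → specialForm s i c)) ×-dec
     all? (λ i → rowBalanced? (∑ᶠ (regularForm i)) (∑ᶠ λ s → ∑ᶠ (specialForm s i))) ×-dec
     all? (λ e → fits? (B ℕ.* 4) (progressionOf e)) ×-dec
     all? (λ e → all? λ e′ → ¬? (e Finₚ.≟ e′) →-dec nonOverlapping? (progressionOf e) (progressionOf e′)) ×-dec
     all? (λ e → window (placementOf e) ℕ.≤? L) ×-dec
     all? (λ s → all? λ i → all? λ c → outside? L (placementOf (specialLine s i c)) (specialSlot s i c)) ×-dec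
     all? (λ i → all? λ c → all? λ i′ → all? λ c′ →
       regularLine i c Finₚ.≟ regularLine i′ c′ →-dec (i Finₚ.≟ i′) ×-dec (c Finₚ.≟ c′)) ×-dec
     all? (λ s → all? λ i → all? λ c → all? λ s′ → all? λ i′ → all? λ c′ →
       specialLine s i c Finₚ.≟ specialLine s′ i′ c′ →-dec
       specialSlot s i c ≟ˢ specialSlot s′ i′ c′ →-dec
       (s Finₚ.≟ s′) ×-dec (i Finₚ.≟ i′) ×-dec (c Finₚ.≟ c′)))
    where open Finₚ using (all?)

module Construction {B L NL : ℕ} (T : Table B L NL) (valid : Valid T) (K : ℕ) where
  open Table T
  open Valid valid

  k : ℕ
  k = L ℕ.+ K

  Block : Set
  Block = Fin L ⊎ Fin K

  entry : Fin B → Block → Fin 4 → ℤ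
  entry i (inj₁ s) c = ⟦ specialForm T s i c ⟧ K 0
  entry i (inj₂ b) c = ⟦ regularForm T i c ⟧ K (toℕ b)

  array : Fin B → Fin (k ℕ.* 4) → ℤ
  array i j = entry i (splitAt L (quotient {k} 4 j)) (remainder {k} 4 j)

  row : ∀ i → ∑ (array i) ≡ 0ℤ
  row i = begin
    ∑ (array i)
      ≡⟨ ∑-remQuot k (λ q → entry i (splitAt L q)) ⟩
    ∑ (λ q → ∑ (entry i (splitAt L q)))
      ≡⟨ ∑-splitAt L (λ β → ∑ (entry i β)) ⟩
    ∑ (λ s → ∑ (entry i (inj₁ s))) + ∑ (λ b → ∑ (entry i (inj₂ b)))
      ≡⟨ cong₂ _+_ special regular ⟩
    ⟦ Q ⟧ K 0 + ∑ {K} (λ b → ⟦ R ⟧ K (toℕ b))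
      ≡⟨ balanced-row R Q K (balancedRows i) ⟩
    0ℤ ∎
    where
    open ≡-Reasoning
    R Q : Form
    R = ∑ᶠ (regularForm T i)
    Q = ∑ᶠ λ s → ∑ᶠ (specialForm T s i)
    special : ∑ (λ s → ∑ (entry i (inj₁ s))) ≡ ⟦ Q ⟧ K 0
    special = sym (trans (⟦∑ᶠ⟧ (λ s → ∑ᶠ (specialForm T s i)) K 0)
                         (∑-cong λ s → ⟦∑ᶠ⟧ (specialForm T s i) K 0))
    regular : ∑ (λ b → ∑ (entry i (inj₂ b))) ≡ ∑ {K} (λ b → ⟦ R ⟧ K (toℕ b))
    regular = ∑-cong {K} λ b → sym (⟦∑ᶠ⟧ (regularForm T i) K (toℕ b))

  column : ∀ β c → ∑ (λ i → entry i β c) ≡ 0ℤ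
  column (inj₁ s) c = trans (sym (⟦∑ᶠ⟧ (λ i → specialForm T s i c) K 0)) (⟦⟧-zero _ K 0 (specialColumns s c))
  column (inj₂ b) c = trans (sym (⟦∑ᶠ⟧ (λ i → regularForm T i c) K (toℕ b))) (⟦⟧-zero _ K (toℕ b) (regularColumns c))

  cellLine : Fin B → Block → Fin 4 → Fin NL
  cellLine i (inj₁ s) c = specialLine s i c
  cellLine i (inj₂ b) c = regularLine i c

  cellPosition : Fin B → Block → Fin 4 → ℕ
  cellPosition i (inj₁ s) c = slotPosition K (specialSlot s i c)
  cellPosition i (inj₂ b) c = position (placementOf (regularLine i c)) b

  ∣entry∣ : ∀ i β c → ∣ entry i β c ∣ ≡ term (progressionOf (cellLine i β c)) k (cellPosition i β c)
  ∣entry∣ i (inj₁ s) c = ∣signed∣ (specialSign s i c) _ K 0 (term-slot L K _ (specialSlot s i c))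
  ∣entry∣ i (inj₂ b) c = ∣signed∣ (regularSign i c) _ K (toℕ b) (term-placement L K _ (placementOf (regularLine i c)) b)

  cellPosition< : ∀ i β c → cellPosition i β c < k
  cellPosition< i (inj₁ s) c = slotPosition< _ (specialSlot s i c) (slotsOutside s i c) (windowFits (specialLine s i c))
  cellPosition< i (inj₂ b) c = position< (placementOf (regularLine i c)) b (windowFits (regularLine i c))

  slotOutsideLine : ∀ {e} s i c → specialLine s i c ≡ e → Outside L (placementOf e) (specialSlot s i c)
  slotOutsideLine s i c refl = slotsOutside s i c

  cell-injective : ∀ i β c i′ β′ c′ → cellLine i β c ≡ cellLine i′ β′ c′ →
                   cellPosition i β c ≡ cellPosition i′ β′ c′ → i ≡ i′ × β ≡ β′ × c ≡ c′
  cell-injective i (inj₂ b) c i′ (inj₂ b′) c′ e p with regularLine-injective i c i′ c′ e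
  ... | refl , refl = refl , cong inj₂ (position-injective (placementOf (regularLine i c)) p) , refl
  cell-injective i (inj₂ b) c i′ (inj₁ s′) c′ e p =
    ⊥-elim (position≢slotPosition _ b _ (slotOutsideLine s′ i′ c′ (sym e)) p)
  cell-injective i (inj₁ s) c i′ (inj₂ b′) c′ e p =
    ⊥-elim (position≢slotPosition _ b′ _ (slotOutsideLine s i c e) (sym p))
  cell-injective i (inj₁ s) c i′ (inj₁ s′) c′ e p
    with specialLine-injective s i c s′ i′ c′ e
           (slotPosition-injective _ _ _ (slotsOutside s i c) (slotOutsideLine s′ i′ c′ (sym e)) p)
  ... | refl , refl , refl = refl , refl , refl

  term-injective : ∀ e e′ {p p′} → p < k → p′ < k →
                   term (progressionOf e) k p ≡ term (progressionOf e′) k p′ → e ≡ e′ × p ≡ p′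
  term-injective e e′ p<k p′<k eq with e Finₚ.≟ e′
  ... | yes refl = refl , term-injectiveʳ (progressionOf e) (proj₁ (fits e)) eq
  ... | no e≢e′  = ⊥-elim (term-apart (nonOverlapping e e′ e≢e′) (proj₁ (fits e)) (proj₁ (fits e′)) p<k p′<k eq)

  entry-injective : ∀ i β c i′ β′ c′ → ∣ entry i β c ∣ ≡ ∣ entry i′ β′ c′ ∣ → i ≡ i′ × β ≡ β′ × c ≡ c′
  entry-injective i β c i′ β′ c′ eq = uncurry (cell-injective i β c i′ β′ c′)
    (term-injective _ _ (cellPosition< i β c) (cellPosition< i′ β′ c′)
      (trans (sym (∣entry∣ i β c)) (trans eq (∣entry∣ i′ β′ c′))))

  entry≤ : ∀ i β c → ∣ entry i β c ∣ ≤ B ℕ.* (k ℕ.* 4)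
  entry≤ i β c = subst (_≤ B ℕ.* (k ℕ.* 4)) (sym (∣entry∣ i β c))
    (ℕ.≤-trans (term-≤ (progressionOf e) (proj₁ (fits e)) (cellPosition< i β c))
    (ℕ.≤-trans (ℕ.*-monoˡ-≤ k (proj₂ (fits e))) (ℕ.≤-reflexive (regroup B k))))
    where
    e : Fin NL
    e = cellLine i β c
    regroup : ∀ B k → B ℕ.* 4 ℕ.* k ≡ B ℕ.* (k ℕ.* 4)
    regroup = ℕ-Solver.solve-∀

  column-injective : ∀ {j j′ : Fin (k ℕ.* 4)} → splitAt L (quotient {k} 4 j) ≡ splitAt L (quotient {k} 4 j′) →
                     remainder {k} 4 j ≡ remainder {k} 4 j′ → j ≡ j′
  column-injective eq₁ eq₂ = remQuot-injective {k} 4 (cong₂ _,_ (splitAt-injective L eq₁) eq₂)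

  isHeffter : IsIntegerHeffter B (k ℕ.* 4) array
  isHeffter = record
    { rowSum   = row
    ; colSum   = λ j → column (block j) (remainder {k} 4 j)
    ; absPos   = λ i j → subst (1 ≤_) (sym (∣entry∣ i (block j) (remainder {k} 4 j))) (s≤s z≤n)
    ; absBound = λ i j → entry≤ i (block j) (remainder {k} 4 j)
    ; absInj   = λ i j i′ j′ eq →
        let i≡i′ , β≡β′ , c≡c′ = entry-injective i (block j) (remainder {k} 4 j) i′ (block j′) (remainder {k} 4 j′) eq
        in i≡i′ , column-injective β≡β′ c≡c′
    }
    where
    block : Fin (k ℕ.* 4) → Block
    block j = splitAt L (quotient {k} 4 j)

  heffter : HeffterArray B (k ℕ.* 4)
  heffter = array , isHeffter

-- Base cases

grid : ∀ {A : Set} {m n} → Vec (Vec A n) m → Fin m → Fin n → A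
grid rows i j = lookup (lookup rows i) j

T₃ : Table 3 2 12
T₃ = record
  { progressionOf = lookup
      (prog 0 2 0 ∷ prog 0 2 1 ∷ prog 2 1 0 ∷ prog 3 2 0 ∷ prog 3 2 1 ∷ prog 5 1 0 ∷
       prog 6 1 0 ∷ prog 7 1 0 ∷ prog 8 1 0 ∷ prog 9 1 0 ∷ prog 10 1 0 ∷ prog 11 1 0 ∷ [])
  ; placementOf = lookup
      (up 0 ∷ up 0 ∷ up 0 ∷ down 2 ∷ up 0 ∷ down 2 ∷ down 2 ∷ down 2 ∷ up 0 ∷ up 1 ∷ down 2 ∷ up 1 ∷ [])
  ; regularLine = grid
      ((# 0 ∷ # 1 ∷ # 3 ∷ # 4 ∷ []) ∷ (# 7 ∷ # 10 ∷ # 6 ∷ # 9 ∷ []) ∷ (# 8 ∷ # 11 ∷ # 2 ∷ # 5 ∷ []) ∷ [])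
  ; regularSign = grid
      ((⁺ ∷ ⁻ ∷ ⁺ ∷ ⁻ ∷ []) ∷ (⁺ ∷ ⁻ ∷ ⁻ ∷ ⁺ ∷ []) ∷ (⁻ ∷ ⁺ ∷ ⁺ ∷ ⁻ ∷ []) ∷ [])
  ; specialLine = grid ∘ lookup
      (((# 0 ∷ # 1 ∷ # 3 ∷ # 5 ∷ []) ∷ (# 7 ∷ # 10 ∷ # 6 ∷ # 9 ∷ []) ∷ (# 8 ∷ # 11 ∷ # 2 ∷ # 4 ∷ []) ∷ []) ∷
       ((# 7 ∷ # 9 ∷ # 4 ∷ # 2 ∷ []) ∷ (# 0 ∷ # 11 ∷ # 10 ∷ # 3 ∷ []) ∷ (# 8 ∷ # 1 ∷ # 5 ∷ # 6 ∷ []) ∷ []) ∷ [])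
  ; specialSign = grid ∘ lookup
      (((⁺ ∷ ⁻ ∷ ⁺ ∷ ⁺ ∷ []) ∷ (⁺ ∷ ⁻ ∷ ⁻ ∷ ⁻ ∷ []) ∷ (⁻ ∷ ⁺ ∷ ⁺ ∷ ⁺ ∷ []) ∷ []) ∷
       ((⁺ ∷ ⁻ ∷ ⁻ ∷ ⁻ ∷ []) ∷ (⁺ ∷ ⁺ ∷ ⁺ ∷ ⁻ ∷ []) ∷ (⁻ ∷ ⁻ ∷ ⁻ ∷ ⁺ ∷ []) ∷ []) ∷ [])
  ; specialSlot = grid ∘ lookup
      (((above 0 ∷ above 0 ∷ below 1 ∷ below 1 ∷ []) ∷ (below 1 ∷ below 1 ∷ below 1 ∷ above 1 ∷ []) ∷
        (above 0 ∷ above 1 ∷ above 0 ∷ above 0 ∷ []) ∷ []) ∷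
       ((below 0 ∷ below 0 ∷ above 1 ∷ above 1 ∷ []) ∷ (above 1 ∷ below 0 ∷ below 0 ∷ below 0 ∷ []) ∷
        (above 1 ∷ above 1 ∷ below 0 ∷ below 0 ∷ []) ∷ []) ∷ [])
  }

T₅ : Table 5 0 20
T₅ = record
  { progressionOf = lookup
      (prog 0 1 0 ∷ prog 1 1 0 ∷ prog 2 1 0 ∷ prog 3 1 0 ∷ prog 4 1 0 ∷ prog 5 1 0 ∷ prog 6 1 0 ∷
       prog 7 1 0 ∷ prog 8 2 0 ∷ prog 8 2 1 ∷ prog 10 2 0 ∷ prog 10 2 1 ∷ prog 12 2 0 ∷ prog 12 2 1 ∷
       prog 14 2 0 ∷ prog 14 2 1 ∷ prog 16 2 0 ∷ prog 16 2 1 ∷ prog 18 2 0 ∷ prog 18 2 1 ∷ [])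
  ; placementOf = λ _ → up 0
  ; regularLine = grid
      ((# 0 ∷ # 1 ∷ # 2 ∷ # 3 ∷ []) ∷ (# 4 ∷ # 5 ∷ # 6 ∷ # 7 ∷ []) ∷ (# 10 ∷ # 8 ∷ # 11 ∷ # 9 ∷ []) ∷
       (# 13 ∷ # 16 ∷ # 12 ∷ # 17 ∷ []) ∷ (# 18 ∷ # 15 ∷ # 14 ∷ # 19 ∷ []) ∷ [])
  ; regularSign = grid
      ((⁺ ∷ ⁻ ∷ ⁻ ∷ ⁺ ∷ []) ∷ (⁺ ∷ ⁻ ∷ ⁻ ∷ ⁺ ∷ []) ∷ (⁻ ∷ ⁺ ∷ ⁺ ∷ ⁻ ∷ []) ∷
       (⁻ ∷ ⁻ ∷ ⁺ ∷ ⁺ ∷ []) ∷ (⁺ ∷ ⁺ ∷ ⁻ ∷ ⁻ ∷ []) ∷ [])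
  ; specialLine = λ ()
  ; specialSign = λ ()
  ; specialSlot = λ ()
  }

H₃₄ : HeffterArray 3 4
H₃₄ = A , record
  { rowSum   = from-yes (all? λ i → ∑ (A i) ℤ.≟ 0ℤ)
  ; colSum   = from-yes (all? λ j → ∑ (λ i → A i j) ℤ.≟ 0ℤ)
  ; absPos   = from-yes (all? λ i → all? λ j → 1 ℕ.≤? ∣ A i j ∣)
  ; absBound = from-yes (all? λ i → all? λ j → ∣ A i j ∣ ℕ.≤? 12)
  ; absInj   = from-yes (all? λ i → all? λ j → all? λ i′ → all? λ j′ →
                 ∣ A i j ∣ ℕ.≟ ∣ A i′ j′ ∣ →-dec (i Finₚ.≟ i′) ×-dec (j Finₚ.≟ j′))
  }
  where
  open Finₚ using (all?)
  A : Fin 3 → Fin 4 → ℤ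
  A = grid ((+ 1 ∷ + 2 ∷ + 3 ∷ - + 6 ∷ []) ∷ (+ 8 ∷ - + 12 ∷ - + 7 ∷ + 11 ∷ []) ∷ (- + 9 ∷ + 10 ∷ + 4 ∷ - + 5 ∷ []) ∷ [])

heffter₃ : ∀ k → HeffterArray 3 (suc k ℕ.* 4)
heffter₃ zero    = H₃₄
heffter₃ (suc K) = Construction.heffter T₃ (from-yes (valid? T₃)) K

heffter₅ : ∀ k → HeffterArray 5 (k ℕ.* 4)
heffter₅ = Construction.heffter T₅ (from-yes (valid? T₅))

heffter-odd : ∀ m → 3 ≤ m → m % 2 ≡ 1 → ∀ k → HeffterArray m (suc k ℕ.* 4)
heffter-odd 3 _ _ k = heffter₃ k
heffter-odd 5 _ _ k = heffter₅ (suc k)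
-- `odd` is reused as is: (7 + m) % 2 and (3 + m) % 2 reduce to the same term.
heffter-odd (suc (suc (suc (suc (suc (suc (suc m))))))) _ odd k =
  stack {k = suc k} (heffter-odd (suc (suc (suc m))) (s≤s (s≤s (s≤s z≤n))) odd k)
heffter-odd 4 _ ()
heffter-odd 6 _ ()
heffter-odd 0 ()
heffter-odd 1 (s≤s ())
heffter-odd 2 (s≤s (s≤s ()))

multiple-of-4 : ∀ n → 1 ≤ n → n % 4 ≡ 0 → Σ ℕ λ k → n ≡ suc k ℕ.* 4
multiple-of-4 4 _ _ = 0 , refl
multiple-of-4 (suc (suc (suc (suc (suc n))))) _ div = Product.map suc (cong (4 ℕ.+_)) (multiple-of-4 (suc n) (s≤s z≤n) div)
multiple-of-4 1 _ ()
multiple-of-4 2 _ ()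
multiple-of-4 3 _ ()

theorem8 : ∀ (m n : ℕ) → 3 ≤ m → m % 2 ≡ 1 → 1 ≤ n → n % 4 ≡ 0 →
    Σ (Fin m → Fin n → ℤ) (λ A → IsIntegerHeffter m n A)
theorem8 m n 3≤m odd 1≤n div with multiple-of-4 n 1≤n div
... | k , refl = heffter-odd m 3≤m odd k
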